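{- Let $G$ be a finite simple graph with no isolated vertices, with vertex degrees $d_i$ and maximum degree at most $4$, and suppose $G$ is not the complete graph $K_5$. Then \[R_{ -1}=\sum_{ij\in E(G)}\frac{1}{d_id_j}\ge\frac23.\]
   Context: The sum runs over all edges $ij$ of $G$, with $d_i$ the degree of vertex $i$. (Graphs with maximum degree at most $4$ are called chemical graphs.) -}

module Defs where

open import Data.Nat using (ℕ; zero; suc; _*_; _<_)
open import Data.Fin using (Fin; toℕ)
open import Data.List using (List; sum; map; filter; length; allFin; concatMap)
open import Data.Integer using (+_)
open import Data.Rational using (ℚ; _/_; 0ℚ; _+_)
open import Data.Product using (_×_; _,_)
open import Relation.Nullary using (¬_)
open import Relation.Unary using (Decidable)
open import Relation.Binary.PropositionalEquality using (_≡_)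

record SimpleGraph (n : ℕ) : Set₁ where
  field
    Adj       : Fin n → Fin n → Set
    adj?      : (i j : Fin n) → Relation.Nullary.Dec (Adj i j)
    irrefl    : (i : Fin n) → ¬ Adj i i
    symmetric : {i j : Fin n} → Adj i j → Adj j i
open SimpleGraph public

neighbours : {n : ℕ} → SimpleGraph n → Fin n → List (Fin n)
neighbours G i = filter (adj? G i) (allFin _)

degree : {n : ℕ} → SimpleGraph n → Fin n → ℕ
degree G i = length (neighbours G i)

-- the edge set: each edge {i,j} listed once as an ordered pair with i < j
edges : {n : ℕ} → SimpleGraph n → List (Fin n × Fin n)
edges G = concatMap (λ i → map (λ j → i , j)
            (filter (λ j → Data.Nat._<?_ (toℕ i) (toℕ j)) (neighbours G i)))
          (allFin _)

-- 1/m as a rational (with the harmless convention 1/0 = 0; never used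
-- on edges, since endpoints of an edge have positive degree)
inv : ℕ → ℚ
inv zero    = 0ℚ
inv (suc k) = + 1 / suc k

randic-1 : {n : ℕ} → SimpleGraph n → ℚ
randic-1 G = sum' (map (λ e → inv (degree G (proj₁' e) * degree G (proj₂' e))) (edges G))
  where
  proj₁' : {A B : Set} → A × B → A
  proj₁' (a , _) = a
  proj₂' : {A B : Set} → A × B → B
  proj₂' (_ , b) = b
  sum' : List ℚ → ℚ
  sum' = Data.List.foldr _+_ 0ℚ

IsK5 : {n : ℕ} → SimpleGraph n → Set
IsK5 {n} G = (n ≡ 5) × ((i j : Fin n) → ¬ (i ≡ j) → Adj G i j)

-- Choose weights w(d) ≥ 0 with w(dᵢ) + w(dⱼ) ≤ 1/(dᵢdⱼ) on every edge ij.  Summing over the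
-- edges and double counting gives R₋₁ ≥ Σᵥ dᵥ·w(dᵥ).  For maximum degree 4 the weights
-- 2/9, 7/72, 1/18, 1/36 of the degrees 1, 2, 3, 4 give every vertex a contribution ≥ 1/9, and
-- ≥ 1/6 if its degree is at most 3.  Six or more vertices thus give ≥ 2/3; on five vertices a
-- graph other than K₅ has two non-adjacent vertices, each of degree ≤ 3, giving 2/6 + 3/9 = 2/3;
-- on four vertices all degrees are ≤ 3, giving 4/6.  On two or three vertices all degrees are
-- ≤ 2 and the weights 3/8, 1/8 give contributions 3/8 (degree 1) and 1/4 (degree 2).

module Submission where

open import Defs
open import Data.Nat using (ℕ; _≤_; _<_)
open import Data.Fin using (Fin)
open import Data.Integer using (+_)
open import Data.Rational using (_/_) renaming (_≤_ to _≤ℚ_)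
open import Relation.Nullary using (¬_)

import Data.Nat.Properties as ℕP
open import Algebra.Properties.Semiring.Sum ℕP.+-*-semiring
  using (∑-comm; ∑-distrib-+; sum-remove; *-distribʳ-sum; sum-cong-≗)
  renaming (sum to ∑)
open import Data.Fin using (zero; suc; toℕ; punchIn; punchOut)
import Data.Fin.Properties as FinP
import Data.Integer as ℤ
import Data.Integer.Properties as ℤP
import Data.Integer.Tactic.RingSolver as ℤ-Solver
open import Data.List using (List; []; _∷_; map; filter; length; allFin; concatMap; tabulate; _++_; foldr)
import Data.List.Properties as ListP
open import Data.List.Relation.Unary.All as All using (All; []; _∷_)
import Data.List.Relation.Unary.All.Properties as AllP
open import Data.Nat using (zero; suc; _+_; _*_; z≤n; s≤s; NonZero; _≤?_; _<?_; allUpTo?)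
open import Data.Nat.ListAction using (sum)
open import Data.Nat.ListAction.Properties using (sum-++)
open import Data.Product using (_×_; _,_; ∃₂)
open import Data.Rational as ℚ using (ℚ; 0ℚ)
import Data.Rational.Properties as ℚP
import Data.Rational.Unnormalised as ℚᵘ
import Data.Rational.Unnormalised.Properties as ℚᵘP
open import Data.Vec.Functional using (removeAt)
open import Function using (_∘_; id)
open import Relation.Binary.PropositionalEquality
open import Relation.Nullary using (Dec; yes; no; contradiction; ¬?)
open import Relation.Nullary.Decidable using (True; toWitness; from-yes; _→-dec_)
open import Relation.Unary using (Decidable)

/-distribʳ-+ : ∀ a b d .{{_ : NonZero d}} → + (a + b) / d ≡ + a / d ℚ.+ + b / d
/-distribʳ-+ a b d@(suc k) = ℚP.toℚᵘ-injective (begin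
    ℚ.toℚᵘ (+ (a + b) / d)                  ≈⟨ ℚP.toℚᵘ-fromℚᵘ (ℚᵘ.mkℚᵘ (+ (a + b)) k) ⟩
    ℚᵘ.mkℚᵘ (+ (a + b)) k                   ≈⟨ ℚᵘ.*≡* (trans (cong (ℤ._* (+ d ℤ.* + d)) (ℤP.pos-+ a b))
                                                             (distrib (+ a) (+ b) (+ d))) ⟩
    ℚᵘ.mkℚᵘ (+ a) k ℚᵘ.+ ℚᵘ.mkℚᵘ (+ b) k    ≈⟨ ℚᵘP.+-cong (ℚP.toℚᵘ-fromℚᵘ (ℚᵘ.mkℚᵘ (+ a) k))
                                                          (ℚP.toℚᵘ-fromℚᵘ (ℚᵘ.mkℚᵘ (+ b) k)) ⟨
    ℚ.toℚᵘ (+ a / d) ℚᵘ.+ ℚ.toℚᵘ (+ b / d)  ≈⟨ ℚP.toℚᵘ-homo-+ (+ a / d) (+ b / d) ⟨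
    ℚ.toℚᵘ (+ a / d ℚ.+ + b / d)            ∎)
  where
  open ℚᵘP.≃-Reasoning
  distrib : ∀ x y z → (x ℤ.+ y) ℤ.* (z ℤ.* z) ≡ (x ℤ.* z ℤ.+ y ℤ.* z) ℤ.* z
  distrib = ℤ-Solver.solve-∀

/-monoˡ-≤ : ∀ {a b} d .{{_ : NonZero d}} → a ≤ b → + a / d ≤ℚ + b / d
/-monoˡ-≤ {a} {b} d@(suc k) a≤b = ℚP.toℚᵘ-cancel-≤ (begin
    ℚ.toℚᵘ (+ a / d)  ≃⟨ ℚP.toℚᵘ-fromℚᵘ (ℚᵘ.mkℚᵘ (+ a) k) ⟩
    ℚᵘ.mkℚᵘ (+ a) k   ≤⟨ ℚᵘ.*≤* (ℤP.*-monoʳ-≤-nonNeg (+ d) (ℤ.+≤+ a≤b)) ⟩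
    ℚᵘ.mkℚᵘ (+ b) k   ≃⟨ ℚP.toℚᵘ-fromℚᵘ (ℚᵘ.mkℚᵘ (+ b) k) ⟨
    ℚ.toℚᵘ (+ b / d)  ∎)
  where open ℚᵘP.≤-Reasoning

sum-/-≤ : ∀ {A : Set} (w : A → ℕ) (F : A → ℚ) d .{{_ : NonZero d}} {xs : List A} →
          All (λ x → + w x / d ≤ℚ F x) xs → + sum (map w xs) / d ≤ℚ foldr ℚ._+_ 0ℚ (map F xs)
sum-/-≤ w F d []                     = ℚP.≤-reflexive (ℚP.0/n≡0 d)
sum-/-≤ w F d {x ∷ xs} (wx≤Fx ∷ ws≤Fs) =
  subst (_≤ℚ _) (sym (/-distribʳ-+ (w x) (sum (map w xs)) d)) (ℚP.+-mono-≤ wx≤Fx (sum-/-≤ w F d ws≤Fs))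

∑-mono-≤ : ∀ {n} {f g : Fin n → ℕ} → (∀ i → f i ≤ g i) → ∑ f ≤ ∑ g
∑-mono-≤ {zero}  f≤g = z≤n
∑-mono-≤ {suc n} f≤g = ℕP.+-mono-≤ (f≤g zero) (∑-mono-≤ (f≤g ∘ suc))

∑-const : ∀ n c → ∑ {n} (λ _ → c) ≡ n * c
∑-const zero    c = refl
∑-const (suc n) c = cong (_+_ c) (∑-const n c)

*-≤-∑ : ∀ {n c} (f : Fin n → ℕ) → (∀ i → c ≤ f i) → n * c ≤ ∑ f
*-≤-∑ {n} {c} _ c≤f = subst (_≤ _) (∑-const n c) (∑-mono-≤ c≤f)

∑-≤-* : ∀ {n c} {f : Fin n → ℕ} → (∀ i → f i ≤ c) → ∑ f ≤ n * c
∑-≤-* {n} {c} f≤c = subst (_ ≤_) (∑-const n c) (∑-mono-≤ f≤c)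

sum-remove₂ : ∀ {n} (f : Fin (suc (suc n)) → ℕ) {i j} (i≢j : i ≢ j) →
              ∑ f ≡ f i + (f j + ∑ (removeAt (removeAt f i) (punchOut i≢j)))
sum-remove₂ {n} f {i} {j} i≢j = begin
  ∑ f                                                   ≡⟨ sum-remove {i = i} f ⟩
  f i + ∑ f∖i                                           ≡⟨ cong (_+_ (f i)) (sum-remove {i = punchOut i≢j} f∖i) ⟩
  f i + (f∖i (punchOut i≢j) + ∑ (removeAt f∖i (punchOut i≢j)))
    ≡⟨ cong (λ k → f i + (f k + ∑ (removeAt f∖i (punchOut i≢j)))) (FinP.punchIn-punchOut i≢j) ⟩
  f i + (f j + ∑ (removeAt f∖i (punchOut i≢j)))         ∎
  where
  open ≡-Reasoning
  f∖i : Fin (suc n) → ℕ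
  f∖i = removeAt f i

𝟙 : ∀ {a} {A : Set a} → Dec A → ℕ
𝟙 (yes _) = 1
𝟙 (no _)  = 0

sum-tabulate : ∀ {n} (f : Fin n → ℕ) → sum (tabulate f) ≡ ∑ f
sum-tabulate {zero}  f = refl
sum-tabulate {suc n} f = cong (_+_ (f zero)) (sum-tabulate (f ∘ suc))

sum-map-allFin : ∀ {n} (f : Fin n → ℕ) → sum (map f (allFin n)) ≡ ∑ f
sum-map-allFin f = trans (cong sum (ListP.map-tabulate id f)) (sum-tabulate f)

module _ {A : Set} {ℓ} {P : A → Set ℓ} (P? : Decidable P) where

  length-filter≡sum-𝟙 : ∀ xs → length (filter P? xs) ≡ sum (map (𝟙 ∘ P?) xs)
  length-filter≡sum-𝟙 []       = refl
  length-filter≡sum-𝟙 (x ∷ xs) with P? x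
  ... | yes _ = cong suc (length-filter≡sum-𝟙 xs)
  ... | no _  = length-filter≡sum-𝟙 xs

  sum-map-filter : ∀ (f : A → ℕ) xs → sum (map f (filter P? xs)) ≡ sum (map (λ x → 𝟙 (P? x) * f x) xs)
  sum-map-filter f []       = refl
  sum-map-filter f (x ∷ xs) with P? x
  ... | yes _ = cong₂ _+_ (sym (ℕP.+-identityʳ (f x))) (sum-map-filter f xs)
  ... | no _  = sum-map-filter f xs

sum-map-concatMap : ∀ {A B : Set} (f : B → ℕ) (F : A → List B) xs →
                    sum (map f (concatMap F xs)) ≡ sum (map (sum ∘ map f ∘ F) xs)
sum-map-concatMap f F []       = refl
sum-map-concatMap f F (x ∷ xs) = begin
  sum (map f (F x ++ concatMap F xs))               ≡⟨ cong sum (ListP.map-++ f (F x) _) ⟩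
  sum (map f (F x) ++ map f (concatMap F xs))       ≡⟨ sum-++ (map f (F x)) _ ⟩
  sum (map f (F x)) + sum (map f (concatMap F xs))  ≡⟨ cong (_+_ (sum (map f (F x)))) (sum-map-concatMap f F xs) ⟩
  sum (map f (F x)) + sum (map (sum ∘ map f ∘ F) xs) ∎
  where open ≡-Reasoning

∑∑-symmetrise : ∀ {n} (U : Fin n → Fin n → ℕ) (f : Fin n → ℕ) →
                (∑ λ i → ∑ λ j → U i j * (f i + f j)) ≡ (∑ λ i → ∑ λ j → (U i j + U j i) * f i)
∑∑-symmetrise {n} U f = begin
  (∑ λ i → ∑ λ j → U i j * (f i + f j))
    ≡⟨ sum-cong-≗ (λ i → trans (sum-cong-≗ (λ j → ℕP.*-distribˡ-+ (U i j) (f i) (f j)))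
                                (∑-distrib-+ (λ j → U i j * f i) (λ j → U i j * f j))) ⟩
  ∑ (λ i → ∑ (λ j → U i j * f i) + ∑ (λ j → U i j * f j))
    ≡⟨ ∑-distrib-+ (λ i → ∑ λ j → U i j * f i) (λ i → ∑ λ j → U i j * f j) ⟩
  ∑ (λ i → ∑ λ j → U i j * f i) + ∑ (λ i → ∑ λ j → U i j * f j)
    ≡⟨ cong (_+_ _) (∑-comm (λ i j → U i j * f j)) ⟩
  ∑ (λ i → ∑ λ j → U i j * f i) + ∑ (λ j → ∑ λ i → U i j * f j)
    ≡⟨ ∑-distrib-+ (λ i → ∑ λ j → U i j * f i) (λ i → ∑ λ j → U j i * f i) ⟨
  ∑ (λ i → ∑ (λ j → U i j * f i) + ∑ (λ j → U j i * f i))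
    ≡⟨ sum-cong-≗ (λ i → trans (sum-cong-≗ (λ j → ℕP.*-distribʳ-+ (f i) (U i j) (U j i)))
                                (∑-distrib-+ (λ j → U i j * f i) (λ j → U j i * f i))) ⟨
  (∑ λ i → ∑ λ j → (U i j + U j i) * f i)
    ∎
  where open ≡-Reasoning

𝟙≤1 : ∀ {a} {A : Set a} (A? : Dec A) → 𝟙 A? ≤ 1
𝟙≤1 (yes _) = ℕP.≤-refl
𝟙≤1 (no _)  = z≤n

module _ {n : ℕ} (G : SimpleGraph n) where

  adjacency : Fin n → Fin n → ℕ
  adjacency i j = 𝟙 (adj? G i j)

  upperAdjacency : Fin n → Fin n → ℕ
  upperAdjacency i j = adjacency i j * 𝟙 (toℕ i <? toℕ j)

  adjacency≡0 : ∀ {i j} → ¬ Adj G i j → adjacency i j ≡ 0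
  adjacency≡0 {i} {j} ¬ij with adj? G i j
  ... | yes ij = contradiction ij ¬ij
  ... | no _   = refl

  adjacency≡upper+upperᵀ : ∀ i j → adjacency i j ≡ upperAdjacency i j + upperAdjacency j i
  adjacency≡upper+upperᵀ i j with adj? G i j | adj? G j i
  ... | no _   | no _   = refl
  ... | no ¬ij | yes ji = contradiction (symmetric G ji) ¬ij
  ... | yes ij | no ¬ji = contradiction (symmetric G ij) ¬ji
  ... | yes ij | yes _ with toℕ i <? toℕ j | toℕ j <? toℕ i
  ... | yes i<j | yes j<i = contradiction i<j (ℕP.<⇒≯ j<i)
  ... | yes _   | no _    = refl
  ... | no _    | yes _   = refl
  ... | no i≮j  | no j≮i  = contradiction ij (subst (¬_ ∘ Adj G i) i≡j (irrefl G i))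
    where
    i≡j : i ≡ j
    i≡j = FinP.toℕ-injective (ℕP.≤-antisym (ℕP.≮⇒≥ j≮i) (ℕP.≮⇒≥ i≮j))

  degree≡∑adjacency : ∀ i → degree G i ≡ ∑ (adjacency i)
  degree≡∑adjacency i = trans (length-filter≡sum-𝟙 (adj? G i) (allFin n)) (sum-map-allFin (adjacency i))

  sum-edges : ∀ (w : Fin n × Fin n → ℕ) → sum (map w (edges G)) ≡ (∑ λ i → ∑ λ j → upperAdjacency i j * w (i , j))
  sum-edges w = begin
    sum (map w (edges G))                     ≡⟨ sum-map-concatMap w row (allFin n) ⟩
    sum (map (sum ∘ map w ∘ row) (allFin n))  ≡⟨ sum-map-allFin (sum ∘ map w ∘ row) ⟩
    ∑ (sum ∘ map w ∘ row)                     ≡⟨ sum-cong-≗ sum-row ⟩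
    (∑ λ i → ∑ λ j → upperAdjacency i j * w (i , j)) ∎
    where
    open ≡-Reasoning
    row : Fin n → List (Fin n × Fin n)
    row i = map (i ,_) (filter (λ j → toℕ i <? toℕ j) (neighbours G i))
    sum-row : ∀ i → sum (map w (row i)) ≡ (∑ λ j → upperAdjacency i j * w (i , j))
    sum-row i = begin
      sum (map w (row i))
        ≡⟨ cong sum (ListP.map-∘ (filter i<? (neighbours G i))) ⟨
      sum (map (λ j → w (i , j)) (filter i<? (filter (adj? G i) (allFin n))))
        ≡⟨ sum-map-filter i<? (λ j → w (i , j)) (neighbours G i) ⟩
      sum (map (λ j → 𝟙 (i<? j) * w (i , j)) (filter (adj? G i) (allFin n)))
        ≡⟨ sum-map-filter (adj? G i) (λ j → 𝟙 (i<? j) * w (i , j)) (allFin n) ⟩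
      sum (map (λ j → adjacency i j * (𝟙 (i<? j) * w (i , j))) (allFin n))
        ≡⟨ sum-map-allFin (λ j → adjacency i j * (𝟙 (i<? j) * w (i , j))) ⟩
      (∑ λ j → adjacency i j * (𝟙 (i<? j) * w (i , j)))
        ≡⟨ sum-cong-≗ (λ j → ℕP.*-assoc (adjacency i j) (𝟙 (i<? j)) (w (i , j))) ⟨
      (∑ λ j → upperAdjacency i j * w (i , j)) ∎
      where
      i<? : (j : Fin n) → Dec (toℕ i < toℕ j)
      i<? j = toℕ i <? toℕ j

  handshake : ∀ (f : Fin n → ℕ) → sum (map (λ (i , j) → f i + f j) (edges G)) ≡ (∑ λ i → degree G i * f i)
  handshake f = begin
    sum (map (λ (i , j) → f i + f j) (edges G))   ≡⟨ sum-edges (λ (i , j) → f i + f j) ⟩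
    (∑ λ i → ∑ λ j → U i j * (f i + f j))         ≡⟨ ∑∑-symmetrise U f ⟩
    (∑ λ i → ∑ λ j → (U i j + U j i) * f i)       ≡⟨ sum-cong-≗ (λ i → sum-cong-≗ (λ j →
                                                       cong (_* f i) (adjacency≡upper+upperᵀ i j))) ⟨
    (∑ λ i → ∑ λ j → adjacency i j * f i)         ≡⟨ sum-cong-≗ (λ i → *-distribʳ-sum (f i) (adjacency i)) ⟨
    (∑ λ i → ∑ (adjacency i) * f i)               ≡⟨ sum-cong-≗ (λ i → cong (_* f i) (degree≡∑adjacency i)) ⟨
    (∑ λ i → degree G i * f i)                    ∎
    where
    open ≡-Reasoning
    U : Fin n → Fin n → ℕ
    U = upperAdjacency

  edges-adjacent : All (λ (i , j) → Adj G i j) (edges G)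
  edges-adjacent = AllP.concat⁺ (AllP.map⁺ (AllP.tabulate⁺ λ i →
    AllP.map⁺ (AllP.filter⁺ (λ j → toℕ i <? toℕ j) (AllP.all-filter (adj? G i) (allFin n)))))

  nonadjacent-pair : ¬ (∀ i j → i ≢ j → Adj G i j) → ∃₂ λ i j → i ≢ j × ¬ Adj G i j
  nonadjacent-pair ¬complete =
    let i , ¬∀j  = FinP.¬∀⟶∃¬ n _ (λ i → FinP.all? (adjacent-if-distinct? i)) ¬complete
        j , ¬adj = FinP.¬∀⟶∃¬ n _ (adjacent-if-distinct? i) ¬∀j
    in i , j , (λ i≡j → ¬adj (λ i≢j → contradiction i≡j i≢j)) , (λ ij → ¬adj (λ _ → ij))
    where
    adjacent-if-distinct? : ∀ i j → Dec (i ≢ j → Adj G i j)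
    adjacent-if-distinct? i j = ¬? (i FinP.≟ j) →-dec adj? G i j

  vertexWeight : (ℕ → ℕ) → Fin n → ℕ
  vertexWeight w i = degree G i * w (degree G i)

  weightedDegreeSum : (ℕ → ℕ) → ℕ
  weightedDegreeSum w = ∑ (vertexWeight w)

  randic-lower-bound : ∀ (w : ℕ → ℕ) d .{{_ : NonZero d}} →
    (∀ i j → Adj G i j → + (w (degree G i) + w (degree G j)) / d ≤ℚ inv (degree G i * degree G j)) →
    + weightedDegreeSum w / d ≤ℚ randic-1 G
  randic-lower-bound w d edge-bound =
    subst (λ s → + s / d ≤ℚ randic-1 G) (handshake (w ∘ degree G))
      (sum-/-≤ _ _ d (All.map (λ { {i , j} → edge-bound i j }) edges-adjacent))

degree<n : ∀ {n} (G : SimpleGraph n) i → degree G i < n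
degree<n {suc m} G i = s≤s (begin
  degree G i                                  ≡⟨ degree≡∑adjacency G i ⟩
  ∑ (adjacency G i)                           ≡⟨ sum-remove {i = i} (adjacency G i) ⟩
  adjacency G i i + ∑ (removeAt (adjacency G i) i)
                                              ≡⟨ cong (λ k → k + ∑ (removeAt (adjacency G i) i)) (adjacency≡0 G (irrefl G i)) ⟩
  ∑ (removeAt (adjacency G i) i)              ≤⟨ ∑-≤-* (λ k → 𝟙≤1 (adj? G i (punchIn i k))) ⟩
  m * 1                                       ≡⟨ ℕP.*-identityʳ m ⟩
  m                                           ∎)
  where open ℕP.≤-Reasoning

nonadjacent⇒2+degree≤n : ∀ {n} (G : SimpleGraph n) {i j} → i ≢ j → ¬ Adj G i j → 2 + degree G i ≤ n
nonadjacent⇒2+degree≤n {1} G {zero} {zero} i≢j _ = contradiction refl i≢j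
nonadjacent⇒2+degree≤n {suc (suc m)} G {i} {j} i≢j ¬ij = s≤s (s≤s (begin
  degree G i                     ≡⟨ degree≡∑adjacency G i ⟩
  ∑ (adjacency G i)              ≡⟨ sum-remove₂ (adjacency G i) i≢j ⟩
  adjacency G i i + (adjacency G i j + ∑ rest)
                                 ≡⟨ cong₂ (λ k l → k + (l + ∑ rest)) (adjacency≡0 G (irrefl G i)) (adjacency≡0 G ¬ij) ⟩
  ∑ rest                         ≤⟨ ∑-≤-* (λ k → 𝟙≤1 (adj? G i (punchIn i (punchIn (punchOut i≢j) k)))) ⟩
  m * 1                          ≡⟨ ℕP.*-identityʳ m ⟩
  m                              ∎))
  where
  open ℕP.≤-Reasoning
  rest : Fin m → ℕ
  rest = removeAt (removeAt (adjacency G i) i) (punchOut i≢j)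

module _ {p} {P : ℕ → Set p} (P? : Decidable P) where

  positiveUpTo-byComputation : ∀ D → {True (allUpTo? (P? ∘ suc) D)} → ∀ {d} → 0 < d → d ≤ D → P d
  positiveUpTo-byComputation D {t} (s≤s z≤n) d≤D = toWitness t d≤D

module _ {p} {R : ℕ → ℕ → Set p} (R? : ∀ a b → Dec (R a b)) where

  positiveUpTo-byComputation₂ : ∀ D → {True (allUpTo? (λ a → allUpTo? (λ b → R? (suc a) (suc b)) D) D)} →
                                ∀ {a b} → 0 < a → a ≤ D → 0 < b → b ≤ D → R a b
  positiveUpTo-byComputation₂ D {t} (s≤s z≤n) a≤D (s≤s z≤n) b≤D = toWitness t a≤D b≤D

-- Weights are in units of 1/288.
weight₄ : ℕ → ℕ
weight₄ 1 = 64
weight₄ 2 = 28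
weight₄ 3 = 16
weight₄ _ = 8

weight₂ : ℕ → ℕ
weight₂ 1 = 108
weight₂ _ = 36

weight₄-admissible : ∀ {a b} → 0 < a → a ≤ 4 → 0 < b → b ≤ 4 → + (weight₄ a + weight₄ b) / 288 ≤ℚ inv (a * b)
weight₄-admissible = positiveUpTo-byComputation₂ (λ a b → + (weight₄ a + weight₄ b) / 288 ℚP.≤? inv (a * b)) 4

weight₂-admissible : ∀ {a b} → 0 < a → a ≤ 2 → 0 < b → b ≤ 2 → + (weight₂ a + weight₂ b) / 288 ≤ℚ inv (a * b)
weight₂-admissible = positiveUpTo-byComputation₂ (λ a b → + (weight₂ a + weight₂ b) / 288 ℚP.≤? inv (a * b)) 2

weight₄-vertex≤4 : ∀ {d} → 0 < d → d ≤ 4 → 32 ≤ d * weight₄ d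
weight₄-vertex≤4 = positiveUpTo-byComputation (λ d → 32 ≤? d * weight₄ d) 4

weight₄-vertex≤3 : ∀ {d} → 0 < d → d ≤ 3 → 48 ≤ d * weight₄ d
weight₄-vertex≤3 = positiveUpTo-byComputation (λ d → 48 ≤? d * weight₄ d) 3

weight₂-vertex≤2 : ∀ {d} → 0 < d → d ≤ 2 → 72 ≤ d * weight₂ d
weight₂-vertex≤2 = positiveUpTo-byComputation (λ d → 72 ≤? d * weight₂ d) 2

weight₂-vertex≤1 : ∀ {d} → 0 < d → d ≤ 1 → 108 ≤ d * weight₂ d
weight₂-vertex≤1 = positiveUpTo-byComputation (λ d → 108 ≤? d * weight₂ d) 1

2/3≤randic-byWeights : ∀ {n} (G : SimpleGraph n) (w : ℕ → ℕ) →
  (∀ i j → Adj G i j → + (w (degree G i) + w (degree G j)) / 288 ≤ℚ inv (degree G i * degree G j)) →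
  192 ≤ weightedDegreeSum G w → + 2 / 3 ≤ℚ randic-1 G
-- + 192 / 288 and + 2 / 3 have the same normal form.
2/3≤randic-byWeights G w edge-bound 192≤ = ℚP.≤-trans (/-monoˡ-≤ 288 192≤) (randic-lower-bound G w 288 edge-bound)

weight₂-sum : ∀ {m} (G : SimpleGraph (2 + m)) → m ≤ 1 → (∀ i → 0 < degree G i) →
              192 ≤ weightedDegreeSum G weight₂
weight₂-sum {0} G _ pos =
  ℕP.≤-trans (from-yes (192 ≤? 216)) (*-≤-∑ (vertexWeight G weight₂) λ i → weight₂-vertex≤1 (pos i) (ℕP.≤-pred (degree<n G i)))
weight₂-sum {1} G _ pos =
  ℕP.≤-trans (from-yes (192 ≤? 216)) (*-≤-∑ (vertexWeight G weight₂) λ i → weight₂-vertex≤2 (pos i) (ℕP.≤-pred (degree<n G i)))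
weight₂-sum {suc (suc _)} G (s≤s ()) _

weight₄-sum : ∀ {m} (G : SimpleGraph (4 + m)) → (∀ i → 0 < degree G i) → (∀ i → degree G i ≤ 4) → ¬ IsK5 G →
              192 ≤ weightedDegreeSum G weight₄
weight₄-sum {0} G pos _ _ = *-≤-∑ (vertexWeight G weight₄) λ i → weight₄-vertex≤3 (pos i) (ℕP.≤-pred (degree<n G i))
weight₄-sum {1} G pos ≤4 ¬K5 with nonadjacent-pair G (λ complete → ¬K5 (refl , complete))
... | i , j , i≢j , ¬ij = begin
  192                                  ≤⟨ ℕP.+-mono-≤ (weight₄-vertex≤3 (pos i) (degree≤3 i≢j ¬ij))
                                            (ℕP.+-mono-≤ (weight₄-vertex≤3 (pos j) (degree≤3 (i≢j ∘ sym) (¬ij ∘ symmetric G)))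
                                              (*-≤-∑ (V ∘ others) λ k → weight₄-vertex≤4 (pos (others k)) (≤4 (others k)))) ⟩
  V i + (V j + ∑ (V ∘ others))         ≡⟨ sum-remove₂ V i≢j ⟨
  ∑ V                                  ∎
  where
  open ℕP.≤-Reasoning
  V : Fin 5 → ℕ
  V = vertexWeight G weight₄
  others : Fin 3 → Fin 5
  others = punchIn i ∘ punchIn (punchOut i≢j)
  degree≤3 : ∀ {k l} → k ≢ l → ¬ Adj G k l → degree G k ≤ 3
  degree≤3 k≢l ¬kl = ℕP.≤-pred (ℕP.≤-pred (nonadjacent⇒2+degree≤n G k≢l ¬kl))
weight₄-sum {suc (suc m)} G pos ≤4 _ =
  ℕP.≤-trans (ℕP.*-monoˡ-≤ 32 (ℕP.m≤m+n 6 m)) (*-≤-∑ (vertexWeight G weight₄) λ i → weight₄-vertex≤4 (pos i) (≤4 i))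

2/3≤randic-small : ∀ {m} (G : SimpleGraph (2 + m)) → m ≤ 1 → (∀ i → 0 < degree G i) → + 2 / 3 ≤ℚ randic-1 G
2/3≤randic-small G m≤1 pos = 2/3≤randic-byWeights G weight₂
  (λ i j _ → weight₂-admissible (pos i) (degree≤2 i) (pos j) (degree≤2 j)) (weight₂-sum G m≤1 pos)
  where
  degree≤2 : ∀ i → degree G i ≤ 2
  degree≤2 i = ℕP.≤-pred (ℕP.<-≤-trans (degree<n G i) (s≤s (s≤s m≤1)))

corollary5 : {n : ℕ} (G : SimpleGraph n)
    → 0 < n
    → ((i : Fin n) → 0 < degree G i)
    → ((i : Fin n) → degree G i ≤ 4)
    → ¬ IsK5 G
    → (+ 2 / 3) ≤ℚ randic-1 G
corollary5 {0} G ()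
corollary5 {1} G _ pos _ _ = contradiction (ℕP.≤-pred (degree<n G zero)) (ℕP.<⇒≱ (pos zero))
corollary5 {2} G _ pos _ _ = 2/3≤randic-small G z≤n pos
corollary5 {3} G _ pos _ _ = 2/3≤randic-small G (s≤s z≤n) pos
corollary5 {suc (suc (suc (suc m)))} G _ pos ≤4 ¬K5 =
  2/3≤randic-byWeights G weight₄ (λ i j _ → weight₄-admissible (pos i) (≤4 i) (pos j) (≤4 j)) (weight₄-sum G pos ≤4 ¬K5)
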